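{- There is a translation, producing output of at most exponential size, mapping every $\mathcal{ALC}\iota_L$ concept $C$ to an $\mathcal{ALC}\iota_G$ concept $C'$ that is equivalent to it, i.e. $C^{\mathcal{I}}=C'^{\mathcal{I}}$ for every interpretation $\mathcal{I}$. Moreover, there is a polynomial translation mapping every $\mathcal{ALC}\iota_L$ ontology $\mathcal{O}$ to an $\mathcal{ALC}\iota_G$ ontology that is a conservative extension of $\mathcal{O}$.
   Context: $\mathcal{ALC}\iota$ concepts: $C ::= A \mid \neg C \mid (C\sqcap C) \mid \exists r.C \mid \{\iota C\} \mid \iota C.C$ with $A$ an atomic concept, $r$ a role. $\mathcal{ALC}\iota_L$ is the fragment without constructs $\iota C.D$; $\mathcal{ALC}\iota_G$ the fragment without constructs $\{\iota C\}$. Semantics: interpretations $\mathcal{I}=(\Delta^{\mathcal{I}},\cdot^{\mathcal{I}})$ with standard semantics for $\neg,\sqcap,\exists r$; $(\{\iota C\})^{\mathcal{I}}=\{d\}$ if $C^{\mathcal{I}}=\{d\}$, else $\emptyset$; $(\iota C.D)^{\mathcal{I}}=\Delta^{\mathcal{I}}$ if $C^{\mathcal{I}}=\{d\}\subseteq D^{\mathcal{I}}$ for some $d$, else $\emptyset$. An ontology is a finite set of concept inclusions $C\sqsubseteq D$ and assertions $a:C$, $r:(a,b)$, with the usual satisfaction relation. A conservative extension $\mathcal{O}'$ of $\mathcal{O}$ (possibly using fresh symbols) is one such that every model of $\mathcal{O}'$ is a model of $\mathcal{O}$ and every model of $\mathcal{O}$ can be expanded (by interpreting the fresh symbols) to a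 model of $\mathcal{O}'$. -}

module Defs where

open import Data.Nat using (ℕ; suc; _+_)
open import Data.List using (List; []; _∷_; _++_)
open import Data.List.Relation.Unary.All using (All)
open import Data.List.Membership.Propositional using (_∈_)
open import Data.Product using (Σ; _×_)
open import Data.Empty using (⊥)
open import Data.Unit using (⊤)
open import Relation.Nullary using (¬_)
open import Relation.Binary.PropositionalEquality using (_≡_)
open import Function.Bundles using (_⇔_)

ConceptName = ℕ
RoleName = ℕ
IndName = ℕ

data Concept : Set where
  atom : ConceptName → Concept
  neg  : Concept → Concept
  and  : Concept → Concept → Concept
  ex   : RoleName → Concept → Concept
  defd : Concept → Concept              -- {ι C}   (local definite description)
  iota : Concept → Concept → Concept    -- ι C . D (global definite description)

IsL : Concept → Set
IsL (atom _)   = ⊤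
IsL (neg C)    = IsL C
IsL (and C D)  = IsL C × IsL D
IsL (ex _ C)   = IsL C
IsL (defd C)   = IsL C
IsL (iota _ _) = ⊥

IsG : Concept → Set
IsG (atom _)   = ⊤
IsG (neg C)    = IsG C
IsG (and C D)  = IsG C × IsG D
IsG (ex _ C)   = IsG C
IsG (defd _)   = ⊥
IsG (iota C D) = IsG C × IsG D

size : Concept → ℕ
size (atom _)   = 1
size (neg C)    = suc (size C)
size (and C D)  = suc (size C + size D)
size (ex _ C)   = suc (size C)
size (defd C)   = suc (size C)
size (iota C D) = suc (size C + size D)

record Interp (Δ : Set) : Set₁ where
  field
    conc : ConceptName → Δ → Set
    role : RoleName → Δ → Δ → Set
    ind  : IndName → Δ
open Interp public

⟦_⟧ : {Δ : Set} → Concept → Interp Δ → Δ → Set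
⟦ atom A ⟧ I d   = conc I A d
⟦ neg C ⟧ I d    = ¬ ⟦ C ⟧ I d
⟦ and C D ⟧ I d  = ⟦ C ⟧ I d × ⟦ D ⟧ I d
⟦ ex r C ⟧ I d   = Σ _ λ e → role I r d e × ⟦ C ⟧ I e
⟦ defd C ⟧ I d   = ⟦ C ⟧ I d × (∀ e → ⟦ C ⟧ I e → e ≡ d)
⟦ iota C D ⟧ I _ = Σ _ λ e → ⟦ C ⟧ I e × (∀ e' → ⟦ C ⟧ I e' → e' ≡ e) × ⟦ D ⟧ I e

Equivalent : Concept → Concept → Set₁
Equivalent C C' = ∀ (Δ : Set) (I : Interp Δ) (d : Δ) → ⟦ C ⟧ I d ⇔ ⟦ C' ⟧ I d

data Axiom : Set where
  incl    : Concept → Concept → Axiom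
  cassert : IndName → Concept → Axiom
  rassert : RoleName → IndName → IndName → Axiom

Ontology = List Axiom

_⊨ₐ_ : {Δ : Set} → Interp Δ → Axiom → Set
I ⊨ₐ incl C D      = ∀ d → ⟦ C ⟧ I d → ⟦ D ⟧ I d
I ⊨ₐ cassert a C   = ⟦ C ⟧ I (ind I a)
I ⊨ₐ rassert r a b = role I r (ind I a) (ind I b)

_⊨_ : {Δ : Set} → Interp Δ → Ontology → Set
I ⊨ O = All (I ⊨ₐ_) O

AxIsL : Axiom → Set
AxIsL (incl C D)      = IsL C × IsL D
AxIsL (cassert _ C)   = IsL C
AxIsL (rassert _ _ _) = ⊤

AxIsG : Axiom → Set
AxIsG (incl C D)      = IsG C × IsG D
AxIsG (cassert _ C)   = IsG C
AxIsG (rassert _ _ _) = ⊤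

OntIsL : Ontology → Set
OntIsL O = All AxIsL O

OntIsG : Ontology → Set
OntIsG O = All AxIsG O

axSize : Axiom → ℕ
axSize (incl C D)      = suc (size C + size D)
axSize (cassert _ C)   = suc (size C)
axSize (rassert _ _ _) = 1

ontSize : Ontology → ℕ
ontSize []       = 0
ontSize (α ∷ O)  = axSize α + ontSize O

cNames : Concept → List ConceptName
cNames (atom A)   = A ∷ []
cNames (neg C)    = cNames C
cNames (and C D)  = cNames C ++ cNames D
cNames (ex _ C)   = cNames C
cNames (defd C)   = cNames C
cNames (iota C D) = cNames C ++ cNames D

rNames : Concept → List RoleName
rNames (atom _)   = []
rNames (neg C)    = rNames C
rNames (and C D)  = rNames C ++ rNames D
rNames (ex r C)   = r ∷ rNames C
rNames (defd C)   = rNames C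
rNames (iota C D) = rNames C ++ rNames D

axCNames : Axiom → List ConceptName
axCNames (incl C D)      = cNames C ++ cNames D
axCNames (cassert _ C)   = cNames C
axCNames (rassert _ _ _) = []

axRNames : Axiom → List RoleName
axRNames (incl C D)      = rNames C ++ rNames D
axRNames (cassert _ C)   = rNames C
axRNames (rassert r _ _) = r ∷ []

axINames : Axiom → List IndName
axINames (incl _ _)      = []
axINames (cassert a _)   = a ∷ []
axINames (rassert _ a b) = a ∷ b ∷ []

ontCNames ontRNames ontINames : Ontology → List ℕ
ontCNames []      = []
ontCNames (α ∷ O) = axCNames α ++ ontCNames O
ontRNames []      = []
ontRNames (α ∷ O) = axRNames α ++ ontRNames O
ontINames []      = []
ontINames (α ∷ O) = axINames α ++ ontINames O

AgreeOn : {Δ : Set} → Ontology → Interp Δ → Interp Δ → Set₁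
AgreeOn O I J =
  (∀ A → A ∈ ontCNames O → conc J A ≡ conc I A) ×
  (∀ r → r ∈ ontRNames O → role J r ≡ role I r) ×
  (∀ a → a ∈ ontINames O → ind J a ≡ ind I a)

ConservativeExtension : Ontology → Ontology → Set₁
ConservativeExtension O' O =
  (∀ (Δ : Set) (I : Interp Δ) → I ⊨ O' → I ⊨ O) ×
  (∀ (Δ : Set) (I : Interp Δ) → I ⊨ O →
     Σ (Interp Δ) λ J → (J ⊨ O') × AgreeOn O I J)

-- A local description {ι C} denotes the same set as C ⊓ ι C . C, so rewriting every {ι C} this way
-- gives an equivalent ALCι_G concept; as C is copied three times, the size can grow by a factor of
-- four per nesting level.  For ontologies the copying is avoided by naming: {ι C} becomes
-- A_C ⊓ ι A_C . A_C for a fresh concept name A_C, and the axioms A_C ⊑ C′ and C′ ⊑ A_C (C′ the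
-- translation of C) are added, which keeps the output linear.  In any model of the new ontology
-- these axioms force A_C = C, so it is a model of the old one; conversely, a model of the old
-- ontology becomes a model of the new one by interpreting each A_C as C.
module Submission where

open import Defs
open import Data.Nat using (ℕ; zero; suc; _+_; _*_; _^_; _≤_; _<_; s≤s; z≤n)
open import Data.Nat.Properties
open import Data.Nat.Binary using (ℕᵇ; 2[1+_]; 1+[2_]; toℕ) renaming (zero to zeroᵇ)
open import Data.Nat.Binary.Properties using (toℕ-injective)
open import Data.Nat.Tactic.RingSolver using (solve-∀)
open import Data.Product using (Σ; _×_; _,_; proj₁; map₁)
open import Data.List using ([]; _∷_; _++_; concatMap)
open import Data.List.Extrema.Nat using (max; xs≤max)
open import Data.List.Relation.Unary.All as All using (All; []; _∷_)
open import Data.List.Relation.Unary.All.Properties using (++⁺; ++⁻)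
open import Data.Maybe using (Maybe; just; nothing; _>>=_)
import Data.Maybe as Maybe
open import Data.Maybe.Properties using (just-injective)
open import Data.Unit using (tt)
open import Function.Bundles using (_⇔_; mk⇔; Equivalence)
open import Function.Base using (_∘_)
open import Function.Definitions using (Injective)
import Function.Properties.Equivalence as ⇔
open import Function.Related.TypeIsomorphisms using (¬-cong-⇔)
open import Data.Product.Function.NonDependent.Propositional using (_×-⇔_)
open import Relation.Nullary using (¬_; yes; no; contradiction)
open import Relation.Binary.PropositionalEquality
  using (_≡_; refl; sym; trans; cong; subst; module ≡-Reasoning)

open Equivalence

private variable
  Δ : Set
  P Q P′ Q′ : Δ → Set
  R S : Δ → Δ → Set

_≃_ : (Δ → Set) → (Δ → Set) → Set
P ≃ Q = ∀ d → P d ⇔ Q d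

infix 4 _≃_

≃-refl : P ≃ P
≃-refl d = ⇔.refl

≃-sym : P ≃ Q → Q ≃ P
≃-sym P≃Q d = ⇔.sym (P≃Q d)

≃-trans : P ≃ Q → Q ≃ P′ → P ≃ P′
≃-trans P≃Q Q≃P′ d = ⇔.trans (P≃Q d) (Q≃P′ d)

neg-cong : P ≃ Q → (λ d → ¬ P d) ≃ (λ d → ¬ Q d)
neg-cong P≃Q d = ¬-cong-⇔ (P≃Q d)

and-cong : P ≃ Q → P′ ≃ Q′ → (λ d → P d × P′ d) ≃ (λ d → Q d × Q′ d)
and-cong P≃Q P′≃Q′ d = P≃Q d ×-⇔ P′≃Q′ d

ex-cong : R ≡ S → P ≃ Q → (λ d → Σ _ λ e → R d e × P e) ≃ (λ d → Σ _ λ e → S d e × Q e)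
ex-cong refl P≃Q d = mk⇔ (λ (e , de , p) → e , de , to (P≃Q e) p)
                         (λ (e , de , q) → e , de , from (P≃Q e) q)

defd-cong : P ≃ Q → (λ d → P d × (∀ e → P e → e ≡ d)) ≃ (λ d → Q d × (∀ e → Q e → e ≡ d))
defd-cong P≃Q d = mk⇔ (λ (p , unique) → to (P≃Q d) p , λ e q → unique e (from (P≃Q e) q))
                      (λ (q , unique) → from (P≃Q d) q , λ e p → unique e (to (P≃Q e) p))

iota-cong : P ≃ Q → P′ ≃ Q′ →
            (λ (_ : Δ) → Σ Δ λ e → P e × (∀ e′ → P e′ → e′ ≡ e) × P′ e) ≃
            (λ (_ : Δ) → Σ Δ λ e → Q e × (∀ e′ → Q e′ → e′ ≡ e) × Q′ e)
iota-cong P≃Q P′≃Q′ d = mk⇔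
  (λ (e , p , unique , p′) → e , to (P≃Q e) p , (λ e′ q → unique e′ (from (P≃Q e′) q)) , to (P′≃Q′ e) p′)
  (λ (e , q , unique , q′) → e , from (P≃Q e) q , (λ e′ p → unique e′ (to (P≃Q e′) p)) , from (P′≃Q′ e) q′)

defd≃and-iota : (λ d → P d × (∀ e → P e → e ≡ d)) ≃
                (λ d → P d × Σ _ λ e → P e × (∀ e′ → P e′ → e′ ≡ e) × P e)
defd≃and-iota d = mk⇔ (λ (p , unique) → p , d , p , unique , p)
                      (λ (p , e , _ , unique , _) → p , λ e′ p′ → trans (unique e′ p′) (sym (unique d p)))

⊆-antisym : (∀ d → P d → Q d) → (∀ d → Q d → P d) → P ≃ Q
⊆-antisym P⊆Q Q⊆P d = mk⇔ (P⊆Q d) (Q⊆P d)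

⊆-cong : P ≃ P′ → Q ≃ Q′ → (∀ d → P d → Q d) → ∀ d → P′ d → Q′ d
⊆-cong P≃P′ Q≃Q′ P⊆Q d p′ = to (Q≃Q′ d) (P⊆Q d (from (P≃P′ d) p′))

⟦⟧-local : ∀ C {Δ} {I J : Interp Δ} →
           All (λ A → conc I A ≡ conc J A) (cNames C) → All (λ r → role I r ≡ role J r) (rNames C) →
           ⟦ C ⟧ I ≃ ⟦ C ⟧ J
⟦⟧-local (atom A) (A≡ ∷ []) _ d rewrite A≡ = ⇔.refl
⟦⟧-local (neg C) As rs = neg-cong (⟦⟧-local C As rs)
⟦⟧-local (and C D) As rs with ++⁻ (cNames C) As | ++⁻ (rNames C) rs
... | AsC , AsD | rsC , rsD = and-cong (⟦⟧-local C AsC rsC) (⟦⟧-local D AsD rsD)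
⟦⟧-local (ex r C) As (r≡ ∷ rs) = ex-cong r≡ (⟦⟧-local C As rs)
⟦⟧-local (defd C) As rs = defd-cong (⟦⟧-local C As rs)
⟦⟧-local (iota C D) As rs with ++⁻ (cNames C) As | ++⁻ (rNames C) rs
... | AsC , AsD | rsC , rsD = iota-cong (⟦⟧-local C AsC rsC) (⟦⟧-local D AsD rsD)

ontSize-++ : ∀ O O′ → ontSize (O ++ O′) ≡ ontSize O + ontSize O′
ontSize-++ []      O′ = refl
ontSize-++ (α ∷ O) O′ =
  trans (cong (axSize α +_) (ontSize-++ O O′)) (sym (+-assoc (axSize α) (ontSize O) (ontSize O′)))

globalise : Concept → Concept
globalise (atom A)   = atom A
globalise (neg C)    = neg (globalise C)
globalise (and C D)  = and (globalise C) (globalise D)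
globalise (ex r C)   = ex r (globalise C)
globalise (defd C)   = and (globalise C) (iota (globalise C) (globalise C))
globalise (iota C D) = iota (globalise C) (globalise D)

globalise-isG : ∀ C → IsG (globalise C)
globalise-isG (atom A)   = tt
globalise-isG (neg C)    = globalise-isG C
globalise-isG (and C D)  = globalise-isG C , globalise-isG D
globalise-isG (ex r C)   = globalise-isG C
globalise-isG (defd C)   = globalise-isG C , globalise-isG C , globalise-isG C
globalise-isG (iota C D) = globalise-isG C , globalise-isG D

globalise-equivalent : ∀ C → Equivalent C (globalise C)
globalise-equivalent (atom A)   Δ I = ≃-refl
globalise-equivalent (neg C)    Δ I = neg-cong (globalise-equivalent C Δ I)
globalise-equivalent (and C D)  Δ I = and-cong (globalise-equivalent C Δ I) (globalise-equivalent D Δ I)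
globalise-equivalent (ex r C)   Δ I = ex-cong refl (globalise-equivalent C Δ I)
globalise-equivalent (defd C)   Δ I = ≃-trans (defd-cong (globalise-equivalent C Δ I)) defd≃and-iota
globalise-equivalent (iota C D) Δ I = iota-cong (globalise-equivalent C Δ I) (globalise-equivalent D Δ I)

m+m≤4*m : ∀ m → m + m ≤ 4 * m
m+m≤4*m m = +-monoʳ-≤ m (m≤m+n m _)

suc-<-4^suc : ∀ {t} s → t < 4 ^ s → suc t < 4 ^ suc s
suc-<-4^suc {t} s t<4^s = begin
  suc (suc t)     ≤⟨ s≤s (m≤n+m (suc t) t) ⟩
  suc t + suc t   ≤⟨ +-mono-≤ t<4^s t<4^s ⟩
  4 ^ s + 4 ^ s   ≤⟨ m+m≤4*m (4 ^ s) ⟩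
  4 ^ suc s       ∎
  where open ≤-Reasoning

+-<-4^suc : ∀ {t u} s v → t < 4 ^ s → u < 4 ^ v → suc (t + u) < 4 ^ suc (s + v)
+-<-4^suc {t} {u} s v t<4^s u<4^v = begin
  suc (suc (t + u))           ≡⟨ +-suc (suc t) u ⟨
  suc t + suc u               ≤⟨ +-mono-≤ (≤-trans t<4^s (^-monoʳ-≤ 4 (m≤m+n s v)))
                                          (≤-trans u<4^v (^-monoʳ-≤ 4 (m≤n+m v s))) ⟩
  4 ^ (s + v) + 4 ^ (s + v)   ≤⟨ m+m≤4*m (4 ^ (s + v)) ⟩
  4 ^ suc (s + v)             ∎
  where open ≤-Reasoning

thrice-<-4^suc : ∀ {t} s → t < 4 ^ s → suc (t + suc (t + t)) < 4 ^ suc s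
thrice-<-4^suc {t} s t<4^s = begin
  suc (suc (t + suc (t + t)))  ≡⟨ rearrange t ⟩
  3 * suc t                    ≤⟨ *-monoʳ-≤ 3 t<4^s ⟩
  3 * 4 ^ s                    ≤⟨ *-monoˡ-≤ (4 ^ s) (n≤1+n 3) ⟩
  4 ^ suc s                    ∎
  where
  open ≤-Reasoning
  rearrange : ∀ t → suc (suc (t + suc (t + t))) ≡ 3 * suc t
  rearrange = solve-∀

globalise-size : ∀ C → size (globalise C) < 4 ^ size C
globalise-size (atom A)   = s≤s (s≤s z≤n)
globalise-size (neg C)    = suc-<-4^suc (size C) (globalise-size C)
globalise-size (and C D)  = +-<-4^suc (size C) (size D) (globalise-size C) (globalise-size D)
globalise-size (ex r C)   = suc-<-4^suc (size C) (globalise-size C)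
globalise-size (defd C)   = thrice-<-4^suc (size C) (globalise-size C)
globalise-size (iota C D) = +-<-4^suc (size C) (size D) (globalise-size C) (globalise-size D)

push : ℕ → ℕᵇ → ℕᵇ
push zero    b = 1+[2 b ]
push (suc n) b = 2[1+ push n b ]

pop : ℕᵇ → Maybe (ℕ × ℕᵇ)
pop zeroᵇ     = nothing
pop 1+[2 b ]  = just (0 , b)
pop 2[1+ b ]  = Maybe.map (map₁ suc) (pop b)

pop-push : ∀ n b → pop (push n b) ≡ just (n , b)
pop-push zero    b = refl
pop-push (suc n) b = cong (Maybe.map (map₁ suc)) (pop-push n b)

serialise : Concept → ℕᵇ → ℕᵇ
serialise (atom A)   = push 0 ∘ push A
serialise (neg C)    = push 1 ∘ serialise C
serialise (and C D)  = push 2 ∘ serialise C ∘ serialise D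
serialise (ex r C)   = push 3 ∘ push r ∘ serialise C
serialise (defd C)   = push 4 ∘ serialise C
serialise (iota C D) = push 5 ∘ serialise C ∘ serialise D

deserialise : (fuel : ℕ) → ℕᵇ → Maybe (Concept × ℕᵇ)
deserialise zero       b = nothing
deserialise (suc fuel) b with pop b
... | just (0 , b₁) = Maybe.map (map₁ atom) (pop b₁)
... | just (1 , b₁) = Maybe.map (map₁ neg) (deserialise fuel b₁)
... | just (2 , b₁) = deserialise fuel b₁ >>= λ (C , b₂) → Maybe.map (map₁ (and C)) (deserialise fuel b₂)
... | just (3 , b₁) = pop b₁ >>= λ (r , b₂) → Maybe.map (map₁ (ex r)) (deserialise fuel b₂)
... | just (4 , b₁) = Maybe.map (map₁ defd) (deserialise fuel b₁)
... | just (5 , b₁) = deserialise fuel b₁ >>= λ (C , b₂) → Maybe.map (map₁ (iota C)) (deserialise fuel b₂)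
... | _              = nothing

deserialise-serialise : ∀ C b {fuel} → size C ≤ fuel → deserialise fuel (serialise C b) ≡ just (C , b)
deserialise-serialise (atom A) b (s≤s _) rewrite pop-push A b = refl
deserialise-serialise (neg C) b (s≤s C≤f) rewrite deserialise-serialise C b C≤f = refl
deserialise-serialise (and C D) b (s≤s CD≤f)
  rewrite deserialise-serialise C (serialise D b) (m+n≤o⇒m≤o (size C) CD≤f)
        | deserialise-serialise D b (m+n≤o⇒n≤o (size C) CD≤f) = refl
deserialise-serialise (ex r C) b (s≤s C≤f)
  rewrite pop-push r (serialise C b) | deserialise-serialise C b C≤f = refl
deserialise-serialise (defd C) b (s≤s C≤f) rewrite deserialise-serialise C b C≤f = refl
deserialise-serialise (iota C D) b (s≤s CD≤f)
  rewrite deserialise-serialise C (serialise D b) (m+n≤o⇒m≤o (size C) CD≤f)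
        | deserialise-serialise D b (m+n≤o⇒n≤o (size C) CD≤f) = refl

code : Concept → ℕ
code C = toℕ (serialise C zeroᵇ)

code-injective : Injective _≡_ _≡_ code
code-injective {C} {D} codeC≡codeD = cong proj₁ (just-injective (begin
  just (C , zeroᵇ)                    ≡⟨ deserialise-serialise C zeroᵇ (m≤m+n (size C) (size D)) ⟨
  deserialise fuel (serialise C zeroᵇ) ≡⟨ cong (deserialise fuel) (toℕ-injective codeC≡codeD) ⟩
  deserialise fuel (serialise D zeroᵇ) ≡⟨ deserialise-serialise D zeroᵇ (m≤n+m (size D) (size C)) ⟩
  just (D , zeroᵇ)                    ∎))
  where
  open ≡-Reasoning
  fuel = size C + size D

-- N bounds the concept names of the input, and A_C = N + code C.  Since code is injective, the
-- expansion of a model can read C off the name A_C, with no record of which names were used.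
module Abbreviation (N : ℕ) where

  abbr : Concept → ConceptName
  abbr C = N + code C

  abbreviate : Concept → Concept
  abbreviate (atom A)   = atom A
  abbreviate (neg C)    = neg (abbreviate C)
  abbreviate (and C D)  = and (abbreviate C) (abbreviate D)
  abbreviate (ex r C)   = ex r (abbreviate C)
  abbreviate (defd C)   = and (atom (abbr C)) (iota (atom (abbr C)) (atom (abbr C)))
  abbreviate (iota C D) = iota (abbreviate C) (abbreviate D)

  definitions : Concept → Ontology
  definitions (atom A)   = []
  definitions (neg C)    = definitions C
  definitions (and C D)  = definitions C ++ definitions D
  definitions (ex r C)   = definitions C
  definitions (defd C)   = incl (atom (abbr C)) (abbreviate C) ∷ incl (abbreviate C) (atom (abbr C))
                           ∷ definitions C
  definitions (iota C D) = definitions C ++ definitions D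

  abbreviateAxiom : Axiom → Ontology
  abbreviateAxiom (incl C D)      = incl (abbreviate C) (abbreviate D) ∷ definitions C ++ definitions D
  abbreviateAxiom (cassert a C)   = cassert a (abbreviate C) ∷ definitions C
  abbreviateAxiom (rassert r a b) = rassert r a b ∷ []

  abbreviateOntology : Ontology → Ontology
  abbreviateOntology = concatMap abbreviateAxiom

  abbreviate-isG : ∀ C → IsG (abbreviate C)
  abbreviate-isG (atom A)   = tt
  abbreviate-isG (neg C)    = abbreviate-isG C
  abbreviate-isG (and C D)  = abbreviate-isG C , abbreviate-isG D
  abbreviate-isG (ex r C)   = abbreviate-isG C
  abbreviate-isG (defd C)   = tt , tt , tt
  abbreviate-isG (iota C D) = abbreviate-isG C , abbreviate-isG D

  definitions-isG : ∀ C → OntIsG (definitions C)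
  definitions-isG (atom A)   = []
  definitions-isG (neg C)    = definitions-isG C
  definitions-isG (and C D)  = ++⁺ (definitions-isG C) (definitions-isG D)
  definitions-isG (ex r C)   = definitions-isG C
  definitions-isG (defd C)   = (tt , abbreviate-isG C) ∷ (abbreviate-isG C , tt) ∷ definitions-isG C
  definitions-isG (iota C D) = ++⁺ (definitions-isG C) (definitions-isG D)

  abbreviateAxiom-isG : ∀ α → OntIsG (abbreviateAxiom α)
  abbreviateAxiom-isG (incl C D)      =
    (abbreviate-isG C , abbreviate-isG D) ∷ ++⁺ (definitions-isG C) (definitions-isG D)
  abbreviateAxiom-isG (cassert a C)   = abbreviate-isG C ∷ definitions-isG C
  abbreviateAxiom-isG (rassert r a b) = tt ∷ []

  abbreviateOntology-isG : ∀ O → OntIsG (abbreviateOntology O)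
  abbreviateOntology-isG []      = []
  abbreviateOntology-isG (α ∷ O) = ++⁺ (abbreviateAxiom-isG α) (abbreviateOntology-isG O)

  module _ {Δ : Set} {J : Interp Δ} where

    abbreviate-sound : ∀ C → J ⊨ definitions C → ⟦ abbreviate C ⟧ J ≃ ⟦ C ⟧ J
    abbreviate-sound (atom A)   _ = ≃-refl
    abbreviate-sound (neg C)    ⊨defs = neg-cong (abbreviate-sound C ⊨defs)
    abbreviate-sound (and C D)  ⊨defs with ++⁻ (definitions C) ⊨defs
    ... | ⊨C , ⊨D = and-cong (abbreviate-sound C ⊨C) (abbreviate-sound D ⊨D)
    abbreviate-sound (ex r C)   ⊨defs = ex-cong refl (abbreviate-sound C ⊨defs)
    abbreviate-sound (defd C)   (A⊑C ∷ C⊑A ∷ ⊨defs) =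
      ≃-trans (≃-sym defd≃and-iota) (defd-cong (≃-trans (⊆-antisym A⊑C C⊑A) (abbreviate-sound C ⊨defs)))
    abbreviate-sound (iota C D) ⊨defs with ++⁻ (definitions C) ⊨defs
    ... | ⊨C , ⊨D = iota-cong (abbreviate-sound C ⊨C) (abbreviate-sound D ⊨D)

    abbreviateAxiom-sound : ∀ α → J ⊨ abbreviateAxiom α → J ⊨ₐ α
    abbreviateAxiom-sound (incl C D) (C⊑D ∷ ⊨defs) with ++⁻ (definitions C) ⊨defs
    ... | ⊨C , ⊨D = ⊆-cong (abbreviate-sound C ⊨C) (abbreviate-sound D ⊨D) C⊑D
    abbreviateAxiom-sound (cassert a C) (a∈C ∷ ⊨defs) = to (abbreviate-sound C ⊨defs (ind J a)) a∈C
    abbreviateAxiom-sound (rassert r a b) (ab∈r ∷ []) = ab∈r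

    abbreviateOntology-sound : ∀ O → J ⊨ abbreviateOntology O → J ⊨ O
    abbreviateOntology-sound []      [] = []
    abbreviateOntology-sound (α ∷ O) ⊨O′ with ++⁻ (abbreviateAxiom α) ⊨O′
    ... | ⊨α , ⊨O = abbreviateAxiom-sound α ⊨α ∷ abbreviateOntology-sound O ⊨O

  -- The definitions of {ι C} contain C′ twice, so only the combined measure 2 |C′| + |definitions C|
  -- is linear in |C|.
  record WithinBudget (t a s : ℕ) : Set where
    constructor withinBudget
    field budget : 2 * t + a ≤ 14 * s
  open WithinBudget

  budget-suc : ∀ {t a s} → WithinBudget t a s → WithinBudget (suc t) a (suc s)
  budget-suc {t} {a} {s} (withinBudget 2t+a≤14s) = withinBudget (begin
    2 * suc t + a      ≡⟨ cong (_+ a) (*-suc 2 t) ⟩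
    2 + 2 * t + a      ≡⟨ +-assoc 2 (2 * t) a ⟩
    2 + (2 * t + a)    ≤⟨ +-monoʳ-≤ 2 2t+a≤14s ⟩
    2 + 14 * s         ≤⟨ +-monoˡ-≤ (14 * s) (m≤m+n 2 12) ⟩
    14 + 14 * s        ≡⟨ *-suc 14 s ⟨
    14 * suc s         ∎)
    where open ≤-Reasoning

  budget-+ : ∀ {t a s t′ a′ s′} → WithinBudget t a s → WithinBudget t′ a′ s′ →
             WithinBudget (t + t′) (a + a′) (s + s′)
  budget-+ {t} {a} {s} {t′} {a′} {s′} (withinBudget 2t+a≤14s) (withinBudget 2t′+a′≤14s′) = withinBudget (begin
    2 * (t + t′) + (a + a′)      ≡⟨ rearrange t t′ a a′ ⟩
    (2 * t + a) + (2 * t′ + a′)  ≤⟨ +-mono-≤ 2t+a≤14s 2t′+a′≤14s′ ⟩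
    14 * s + 14 * s′             ≡⟨ *-distribˡ-+ 14 s s′ ⟨
    14 * (s + s′)                ∎)
    where
    open ≤-Reasoning
    rearrange : ∀ t t′ a a′ → 2 * (t + t′) + (a + a′) ≡ (2 * t + a) + (2 * t′ + a′)
    rearrange = solve-∀

  budget⇒+≤ : ∀ {t a s} → WithinBudget t a s → t + a ≤ 14 * s
  budget⇒+≤ {t} (withinBudget 2t+a≤14s) = ≤-trans (+-monoˡ-≤ _ (m≤n*m t 2)) 2t+a≤14s

  abbreviation-size : ∀ C → WithinBudget (size (abbreviate C)) (ontSize (definitions C)) (size C)
  abbreviation-size (atom A)   = withinBudget (s≤s (s≤s z≤n))
  abbreviation-size (neg C)    = budget-suc (abbreviation-size C)
  abbreviation-size (and C D)
    rewrite ontSize-++ (definitions C) (definitions D) =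
    budget-suc (budget-+ (abbreviation-size C) (abbreviation-size D))
  abbreviation-size (ex r C)   = budget-suc (abbreviation-size C)
  abbreviation-size (defd C)   = withinBudget (begin
    2 * 5 + (suc (suc t) + (suc (t + 1) + a))  ≡⟨ rearrange t a ⟩
    14 + (2 * t + a)                           ≤⟨ +-monoʳ-≤ 14 (budget (abbreviation-size C)) ⟩
    14 + 14 * size C                           ≡⟨ *-suc 14 (size C) ⟨
    14 * suc (size C)                          ∎)
    where
    open ≤-Reasoning
    t = size (abbreviate C)
    a = ontSize (definitions C)
    rearrange : ∀ t a → 2 * 5 + (suc (suc t) + (suc (t + 1) + a)) ≡ 14 + (2 * t + a)
    rearrange = solve-∀
  abbreviation-size (iota C D)
    rewrite ontSize-++ (definitions C) (definitions D) =
    budget-suc (budget-+ (abbreviation-size C) (abbreviation-size D))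

  abbreviateAxiom-size : ∀ α → ontSize (abbreviateAxiom α) ≤ 14 * axSize α
  abbreviateAxiom-size (incl C D)
    rewrite ontSize-++ (definitions C) (definitions D) =
    budget⇒+≤ (budget-suc (budget-+ (abbreviation-size C) (abbreviation-size D)))
  abbreviateAxiom-size (cassert a C) =
    budget⇒+≤ (budget-suc (abbreviation-size C))
  abbreviateAxiom-size (rassert r a b) = s≤s z≤n

  abbreviateOntology-size : ∀ O → ontSize (abbreviateOntology O) ≤ 14 * ontSize O
  abbreviateOntology-size []      = z≤n
  abbreviateOntology-size (α ∷ O) = begin
    ontSize (abbreviateAxiom α ++ abbreviateOntology O)         ≡⟨ ontSize-++ (abbreviateAxiom α) _ ⟩
    ontSize (abbreviateAxiom α) + ontSize (abbreviateOntology O) ≤⟨ +-mono-≤ (abbreviateAxiom-size α)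
                                                                              (abbreviateOntology-size O) ⟩
    14 * axSize α + 14 * ontSize O                               ≡⟨ *-distribˡ-+ 14 (axSize α) (ontSize O) ⟨
    14 * (axSize α + ontSize O)                                  ∎
    where open ≤-Reasoning

  module Expansion {Δ : Set} (I : Interp Δ) where

    expandedConc : ConceptName → Δ → Set
    expandedConc A with A <? N
    ... | yes _ = conc I A
    ... | no _  = λ d → Σ Concept λ C → abbr C ≡ A × ⟦ C ⟧ I d

    expansion : Interp Δ
    expansion = record I { conc = expandedConc }

    expansion-conc-< : ∀ {A} → A < N → conc expansion A ≡ conc I A
    expansion-conc-< {A} A<N with A <? N
    ... | yes _   = refl
    ... | no A≮N  = contradiction A<N A≮N

    expansion-abbr : ∀ C → conc expansion (abbr C) ≃ ⟦ C ⟧ I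
    expansion-abbr C d with abbr C <? N
    ... | yes abbrC<N = contradiction abbrC<N (m+n≮m N (code C))
    ... | no _        = mk⇔
      (λ (C′ , abbrC′≡abbrC , C′d) → subst (λ D → ⟦ D ⟧ I d) (code-injective {C′} {C} (+-cancelˡ-≡ N _ _ abbrC′≡abbrC)) C′d)
      (λ Cd → C , refl , Cd)

    expansion-local : ∀ C → All (_< N) (cNames C) → ⟦ C ⟧ expansion ≃ ⟦ C ⟧ I
    expansion-local C names =
      ⟦⟧-local C (All.map expansion-conc-< names) (All.universal (λ _ → refl) (rNames C))

    expansion-⊨-definitions : ∀ C → All (_< N) (cNames C) → expansion ⊨ definitions C
    expansion-⊨-definitions (atom A)   _     = []
    expansion-⊨-definitions (neg C)    names = expansion-⊨-definitions C names
    expansion-⊨-definitions (and C D)  names with ++⁻ (cNames C) names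
    ... | namesC , namesD = ++⁺ (expansion-⊨-definitions C namesC) (expansion-⊨-definitions D namesD)
    expansion-⊨-definitions (ex r C)   names = expansion-⊨-definitions C names
    expansion-⊨-definitions (defd C)   names = (λ d → to (abbrC≃C′ d)) ∷ (λ d → from (abbrC≃C′ d)) ∷ ⊨defs
      where
      ⊨defs = expansion-⊨-definitions C names
      abbrC≃C′ : conc expansion (abbr C) ≃ ⟦ abbreviate C ⟧ expansion
      abbrC≃C′ = ≃-trans (expansion-abbr C)
                         (≃-sym (≃-trans (abbreviate-sound C ⊨defs) (expansion-local C names)))
    expansion-⊨-definitions (iota C D) names with ++⁻ (cNames C) names
    ... | namesC , namesD = ++⁺ (expansion-⊨-definitions C namesC) (expansion-⊨-definitions D namesD)

    abbreviate-expansion : ∀ C → All (_< N) (cNames C) → ⟦ abbreviate C ⟧ expansion ≃ ⟦ C ⟧ I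
    abbreviate-expansion C names =
      ≃-trans (abbreviate-sound C (expansion-⊨-definitions C names)) (expansion-local C names)

    expansion-⊨-abbreviateAxiom : ∀ α → All (_< N) (axCNames α) → I ⊨ₐ α → expansion ⊨ abbreviateAxiom α
    expansion-⊨-abbreviateAxiom (incl C D) names C⊑D with ++⁻ (cNames C) names
    ... | namesC , namesD =
      ⊆-cong (≃-sym (abbreviate-expansion C namesC)) (≃-sym (abbreviate-expansion D namesD)) C⊑D
      ∷ ++⁺ (expansion-⊨-definitions C namesC) (expansion-⊨-definitions D namesD)
    expansion-⊨-abbreviateAxiom (cassert a C) names a∈C =
      from (abbreviate-expansion C names (ind I a)) a∈C ∷ expansion-⊨-definitions C names
    expansion-⊨-abbreviateAxiom (rassert r a b) _ ab∈r = ab∈r ∷ []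

    expansion-⊨-abbreviateOntology : ∀ O → All (_< N) (ontCNames O) → I ⊨ O → expansion ⊨ abbreviateOntology O
    expansion-⊨-abbreviateOntology []      _     []         = []
    expansion-⊨-abbreviateOntology (α ∷ O) names (⊨α ∷ ⊨O) with ++⁻ (axCNames α) names
    ... | namesα , namesO =
      ++⁺ (expansion-⊨-abbreviateAxiom α namesα ⊨α) (expansion-⊨-abbreviateOntology O namesO ⊨O)

  abbreviateOntology-conservative : ∀ O → All (_< N) (ontCNames O) →
                                    ConservativeExtension (abbreviateOntology O) O
  abbreviateOntology-conservative O names = (λ Δ I → abbreviateOntology-sound O) , extend
    where
    extend : ∀ Δ (I : Interp Δ) → I ⊨ O → Σ (Interp Δ) λ J → J ⊨ abbreviateOntology O × AgreeOn O I J
    extend Δ I ⊨O = expansion , expansion-⊨-abbreviateOntology O names ⊨O ,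
                    (λ A A∈O → expansion-conc-< (All.lookup names A∈O)) , (λ _ _ → refl) , (λ _ _ → refl)
      where open Expansion I

freshFor : Ontology → ℕ
freshFor O = suc (max 0 (ontCNames O))

ontCNames-<-freshFor : ∀ O → All (_< freshFor O) (ontCNames O)
ontCNames-<-freshFor O = All.map s≤s (xs≤max 0 (ontCNames O))

14*n≤[14+n]^14 : ∀ n → 14 * n ≤ (14 + n) ^ 14
14*n≤[14+n]^14 n = begin
  14 * n              ≤⟨ *-mono-≤ (m≤m+n 14 n) (m≤n+m n 14) ⟩
  (14 + n) * (14 + n) ≡⟨ cong ((14 + n) *_) (*-identityʳ (14 + n)) ⟨
  (14 + n) ^ 2        ≤⟨ ^-monoʳ-≤ (14 + n) (m≤m+n 2 12) ⟩
  (14 + n) ^ 14       ∎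
  where open ≤-Reasoning

-- Both translations are correct on all of ALCι.
proposition1 :
    (Σ (Concept → Concept) λ tr → Σ ℕ λ k →
      ∀ C → IsL C →
        IsG (tr C) × Equivalent C (tr C) × size (tr C) ≤ 2 ^ (k * size C))
    ×
    (Σ (Ontology → Ontology) λ tr → Σ ℕ λ k →
      ∀ O → OntIsL O →
        OntIsG (tr O) × ConservativeExtension (tr O) O × ontSize (tr O) ≤ (k + ontSize O) ^ k)
proposition1 =
  (globalise , 2 , λ C _ →
    globalise-isG C , globalise-equivalent C ,
    ≤-trans (<⇒≤ (globalise-size C)) (≤-reflexive (^-*-assoc 2 2 (size C)))) ,
  ((λ O → abbreviateOntology (freshFor O) O) , 14 , λ O _ →
    abbreviateOntology-isG (freshFor O) O ,
    abbreviateOntology-conservative (freshFor O) O (ontCNames-<-freshFor O) ,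
    ≤-trans (abbreviateOntology-size (freshFor O) O) (14*n≤[14+n]^14 (ontSize O)))
  where open Abbreviation
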